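{- For each choice of the sign $\pm$, the Diophantine equation $x^3\pm y^3=a^4-b^4$ has infinitely many nontrivial solutions $(x,y,a,b)$ in positive integers.
   Context: A quadruple $(x,y,a,b)$ of integers is called a nontrivial solution of an equation $x^3\pm y^3=a^k\pm b^k$ (signs fixed) if $\gcd(x,y,a,b)=1$ and no partial sum in the expression $x^3\pm y^3-(a^k\pm b^k)$ vanishes. -}

module Defs where

open import Data.Nat as ℕ using (ℕ; suc)
open import Data.Nat.GCD using (gcd)
open import Data.Integer as Z using (ℤ; +_; -_; _+_; _-_; _^_; ∣_∣; _<_)
open import Data.Bool using (Bool; true; false)
open import Data.Product using (_×_; _,_; ∃)
open import Data.List using (List)
open import Data.List.Membership.Propositional using (_∈_)
open import Relation.Binary.PropositionalEquality using (_≡_; _≢_)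
open import Relation.Nullary using (¬_)

sgn : Bool → ℤ → ℤ
sgn true  z = z
sgn false z = - z

Quad : Set
Quad = ℤ × ℤ × ℤ × ℤ

IsSolution : Bool → Quad → Set
IsSolution s (x , y , a , b) = x ^ 3 + sgn s (y ^ 3) ≡ a ^ 4 - b ^ 4

NoVanishingPartialSum : ℤ → ℤ → ℤ → ℤ → Set
NoVanishingPartialSum t1 t2 t3 t4 =
  (t1 ≢ + 0) × (t2 ≢ + 0) × (t3 ≢ + 0) × (t4 ≢ + 0) ×
  (t1 + t2 ≢ + 0) × (t1 + t3 ≢ + 0) × (t1 + t4 ≢ + 0) ×
  (t2 + t3 ≢ + 0) × (t2 + t4 ≢ + 0) × (t3 + t4 ≢ + 0) ×
  (t1 + t2 + t3 ≢ + 0) × (t1 + t2 + t4 ≢ + 0) ×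
  (t1 + t3 + t4 ≢ + 0) × (t2 + t3 + t4 ≢ + 0)

NontrivialSolution : Bool → Quad → Set
NontrivialSolution s (x , y , a , b) =
  IsSolution s (x , y , a , b) ×
  gcd (gcd ∣ x ∣ ∣ y ∣) (gcd ∣ a ∣ ∣ b ∣) ≡ 1 ×
  NoVanishingPartialSum (x ^ 3) (sgn s (y ^ 3)) (- (a ^ 4)) (b ^ 4)

Positive : Quad → Set
Positive (x , y , a , b) = (+ 0 < x) × (+ 0 < y) × (+ 0 < a) × (+ 0 < b)

InfinitelyMany : (Quad → Set) → Set
InfinitelyMany P = (L : List Quad) → ∃ λ q → P q × ¬ (q ∈ L)

{-# OPTIONS --safe #-}

-- For +, the identity (t + 1)⁴ − (t − 1)⁴ = (2t)³ + 8t at t = m³ reads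
-- (2m³)³ + (2m)³ = (m³ + 1)⁴ − (m³ − 1)⁴, and for even m the numbers m³ ± 1 are
-- consecutive odd numbers, hence coprime.  For −, the polynomial identity
-- (1 + 22u)(1 + 10u)³ + (1 + 9u)⁴ = (1 + 13u)⁴ + (1 + 12u)³ yields a solution with
-- x = s(1 + 10u) whenever 1 + 22u = s³, i.e. for every s ≡ 1 (mod 22); a common divisor
-- divides 13b − 9a = 4 and the odd number y = 1 + 12u.  Since the four terms sum to zero,
-- a partial sum vanishes iff the complementary one does, so only the single terms and the
-- pairs containing b⁴ need checking: all have a definite sign except b⁴ − a⁴ and, for −,
-- b⁴ − y³ = u²(54 + 1188u + 6561u²).

module Submission where

open import Defs
open import Data.Bool using (Bool; true; false)
open import Data.Product using (_×_; _,_)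
open import Data.Nat as ℕ using (ℕ; NonZero)
import Data.Nat.Properties as ℕ
open import Data.Nat.Divisibility using (_∣_; ∣-trans; ∣1⇒≡1)
open import Data.Nat.GCD using (gcd; gcd[m,n]∣m; gcd[m,n]∣n)
open import Relation.Binary.PropositionalEquality

gcd[gcd,gcd]≡1 : ∀ {x y a b} → (∀ {d} → d ∣ x → d ∣ y → d ∣ a → d ∣ b → d ∣ 1) →
  gcd (gcd x y) (gcd a b) ≡ 1
gcd[gcd,gcd]≡1 {x} {y} {a} {b} common = ∣1⇒≡1 (common
  (∣-trans g∣gcd[x,y] (gcd[m,n]∣m x y)) (∣-trans g∣gcd[x,y] (gcd[m,n]∣n x y))
  (∣-trans g∣gcd[a,b] (gcd[m,n]∣m a b)) (∣-trans g∣gcd[a,b] (gcd[m,n]∣n a b)))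
  where
  g∣gcd[x,y] : gcd (gcd x y) (gcd a b) ∣ gcd x y
  g∣gcd[x,y] = gcd[m,n]∣m (gcd x y) (gcd a b)
  g∣gcd[a,b] : gcd (gcd x y) (gcd a b) ∣ gcd a b
  g∣gcd[a,b] = gcd[m,n]∣n (gcd x y) (gcd a b)

module _ where
  open import Data.Integer using (ℤ; +_; -_; _+_; _-_; _^_; _*_; +<+)
  open import Data.Integer.Properties
    using (pos-*; +-identityʳ; +-inverseʳ; +-comm; +-injective; neg-injective; i-j≡0⇒i≡j)
  open import Data.Integer.Tactic.RingSolver using (solve; solve-∀)
  open import Data.List using ([]; _∷_)
  open ≡-Reasoning

  pos-^ : ∀ n k → (+ n) ^ k ≡ + (n ℕ.^ k)
  pos-^ n ℕ.zero    = refl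
  pos-^ n (ℕ.suc k) = trans (cong (+ n *_) (pos-^ n k)) (sym (pos-* n (n ℕ.^ k)))

  pos≢0 : ∀ {n} → 0 ℕ.< n → + n ≢ + 0
  pos≢0 {ℕ.suc n} _ ()

  neg≢0 : ∀ {i} → i ≢ + 0 → - i ≢ + 0
  neg≢0 i≢0 -i≡0 = i≢0 (neg-injective {j = + 0} -i≡0)

  -m+n≢0 : ∀ {m n} → m ≢ n → - + m + + n ≢ + 0
  -m+n≢0 {m} {n} m≢n -m+n≡0 =
    m≢n (+-injective (sym (i-j≡0⇒i≡j (+ n) (+ m) (trans (+-comm (+ n) (- + m)) -m+n≡0))))

  sgn-≢0 : ∀ s {i} → i ≢ + 0 → sgn s i ≢ + 0
  sgn-≢0 true  i≢0 = i≢0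
  sgn-≢0 false i≢0 = neg≢0 i≢0

  m+n≡o⇒+m≡+o-+n : ∀ {m n o} → m ℕ.+ n ≡ o → + m ≡ + o - + n
  m+n≡o⇒+m≡+o-+n {m} {n} {o} m+n≡o = begin
    + m               ≡⟨ i≡i+j-j (+ m) (+ n) ⟩
    + m + + n - + n   ≡⟨ cong (λ k → + k - + n) m+n≡o ⟩
    + o - + n         ∎
    where
    i≡i+j-j : ∀ i j → i ≡ i + j - j
    i≡i+j-j = solve-∀

  m+n≡o+p⇒+m-+p≡+o-+n : ∀ {m n o p} → m ℕ.+ n ≡ o ℕ.+ p → + m - + p ≡ + o - + n
  m+n≡o+p⇒+m-+p≡+o-+n {m} {n} {o} {p} m+n≡o+p = begin
    + m - + p                   ≡⟨ i-k≡[i+j]-[k+j] (+ m) (+ n) (+ p) ⟩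
    (+ m + + n) - (+ p + + n)   ≡⟨ cong (λ k → + k - (+ p + + n)) m+n≡o+p ⟩
    (+ o + + p) - (+ p + + n)   ≡⟨ [i+k]-[k+j]≡i-j (+ o) (+ n) (+ p) ⟩
    + o - + n                   ∎
    where
    i-k≡[i+j]-[k+j] : ∀ i j k → i - k ≡ (i + j) - (k + j)
    i-k≡[i+j]-[k+j] = solve-∀
    [i+k]-[k+j]≡i-j : ∀ i j k → (i + k) - (k + j) ≡ i - j
    [i+k]-[k+j]≡i-j = solve-∀

  p+q≡r-s⇒p+q-r+s≡0 : ∀ {p q r s} → p + q ≡ r - s → p + q - r + s ≡ + 0
  p+q≡r-s⇒p+q-r+s≡0 {p} {q} {r} {s} p+q≡r-s = begin
    p + q - r + s         ≡⟨ solve (p ∷ q ∷ r ∷ s ∷ []) ⟩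
    (p + q) - (r - s)     ≡⟨ cong (_- (r - s)) p+q≡r-s ⟩
    (r - s) - (r - s)     ≡⟨ +-inverseʳ (r - s) ⟩
    + 0                   ∎

  module _ {t₁ t₂ t₃ t₄ : ℤ} (t₁+t₂+t₃+t₄≡0 : t₁ + t₂ + t₃ + t₄ ≡ + 0) where

    private
      complement≢0 : ∀ {p} q → p ≢ + 0 → p + q ≡ t₁ + t₂ + t₃ + t₄ → q ≢ + 0
      complement≢0 {p} _ p≢0 p+q≡sum refl =
        p≢0 (trans (sym (+-identityʳ p)) (trans p+q≡sum t₁+t₂+t₃+t₄≡0))

    noVanishingPartialSum : t₁ ≢ + 0 → t₂ ≢ + 0 → t₃ ≢ + 0 → t₄ ≢ + 0 →
      t₁ + t₄ ≢ + 0 → t₂ + t₄ ≢ + 0 → t₃ + t₄ ≢ + 0 → NoVanishingPartialSum t₁ t₂ t₃ t₄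
    noVanishingPartialSum t₁≢0 t₂≢0 t₃≢0 t₄≢0 t₁+t₄≢0 t₂+t₄≢0 t₃+t₄≢0 =
      t₁≢0 , t₂≢0 , t₃≢0 , t₄≢0 ,
      complement≢0 (t₁ + t₂) t₃+t₄≢0 (solve (t₁ ∷ t₂ ∷ t₃ ∷ t₄ ∷ [])) ,
      complement≢0 (t₁ + t₃) t₂+t₄≢0 (solve (t₁ ∷ t₂ ∷ t₃ ∷ t₄ ∷ [])) ,
      t₁+t₄≢0 ,
      complement≢0 (t₂ + t₃) t₁+t₄≢0 (solve (t₁ ∷ t₂ ∷ t₃ ∷ t₄ ∷ [])) ,
      t₂+t₄≢0 ,
      t₃+t₄≢0 ,
      complement≢0 (t₁ + t₂ + t₃) t₄≢0 (solve (t₁ ∷ t₂ ∷ t₃ ∷ t₄ ∷ [])) ,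
      complement≢0 (t₁ + t₂ + t₄) t₃≢0 (solve (t₁ ∷ t₂ ∷ t₃ ∷ t₄ ∷ [])) ,
      complement≢0 (t₁ + t₃ + t₄) t₂≢0 (solve (t₁ ∷ t₂ ∷ t₃ ∷ t₄ ∷ [])) ,
      complement≢0 (t₂ + t₃ + t₄) t₁≢0 (solve (t₁ ∷ t₂ ∷ t₃ ∷ t₄ ∷ []))

  nontrivialSolution : ∀ s {x y a b}
    .{{_ : NonZero x}} .{{_ : NonZero y}} .{{_ : NonZero a}} .{{_ : NonZero b}} →
    + (x ℕ.^ 3) + sgn s (+ (y ℕ.^ 3)) ≡ + (a ℕ.^ 4) - + (b ℕ.^ 4) →
    sgn s (+ (y ℕ.^ 3)) + + (b ℕ.^ 4) ≢ + 0 →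
    a ℕ.^ 4 ≢ b ℕ.^ 4 →
    (∀ {d} → d ∣ x → d ∣ y → d ∣ a → d ∣ b → d ∣ 1) →
    Positive (+ x , + y , + a , + b) × NontrivialSolution s (+ x , + y , + a , + b)
  nontrivialSolution s {x} {y} {a} {b} solution t₂+t₄≢0 a⁴≢b⁴ common∣1 =
    positive , isSolution , gcd[gcd,gcd]≡1 common∣1 , noVanishing
    where
    positive : Positive (+ x , + y , + a , + b)
    positive =
      +<+ (ℕ.>-nonZero⁻¹ x) , +<+ (ℕ.>-nonZero⁻¹ y) , +<+ (ℕ.>-nonZero⁻¹ a) , +<+ (ℕ.>-nonZero⁻¹ b)
    isSolution : IsSolution s (+ x , + y , + a , + b)
    isSolution rewrite pos-^ x 3 | pos-^ y 3 | pos-^ a 4 | pos-^ b 4 = solution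
    noVanishing : NoVanishingPartialSum ((+ x) ^ 3) (sgn s ((+ y) ^ 3)) (- ((+ a) ^ 4)) ((+ b) ^ 4)
    noVanishing rewrite pos-^ x 3 | pos-^ y 3 | pos-^ a 4 | pos-^ b 4 =
      noVanishingPartialSum
        (p+q≡r-s⇒p+q-r+s≡0 {+ (x ℕ.^ 3)} {sgn s (+ (y ℕ.^ 3))} {+ (a ℕ.^ 4)} {+ (b ℕ.^ 4)} solution)
        (pos≢0 (ℕ.m^n>0 x 3)) (sgn-≢0 s (pos≢0 (ℕ.m^n>0 y 3)))
        (neg≢0 (pos≢0 (ℕ.m^n>0 a 4))) (pos≢0 (ℕ.m^n>0 b 4))
        (pos≢0 (ℕ.<-≤-trans (ℕ.m^n>0 x 3) (ℕ.m≤m+n (x ℕ.^ 3) (b ℕ.^ 4))))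
        t₂+t₄≢0 (-m+n≢0 a⁴≢b⁴)

  nontrivialSolution-plus : ∀ {x y a b}
    .{{_ : NonZero x}} .{{_ : NonZero y}} .{{_ : NonZero a}} .{{_ : NonZero b}} →
    x ℕ.^ 3 ℕ.+ y ℕ.^ 3 ℕ.+ b ℕ.^ 4 ≡ a ℕ.^ 4 →
    (∀ {d} → d ∣ x → d ∣ y → d ∣ a → d ∣ b → d ∣ 1) →
    Positive (+ x , + y , + a , + b) × NontrivialSolution true (+ x , + y , + a , + b)
  nontrivialSolution-plus {x} {y} {a} {b} x³+y³+b⁴≡a⁴ =
    nontrivialSolution true solution (pos≢0 y³+b⁴>0) (ℕ.>⇒≢ b⁴<a⁴)
    where
    solution : + (x ℕ.^ 3) + + (y ℕ.^ 3) ≡ + (a ℕ.^ 4) - + (b ℕ.^ 4)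
    solution = m+n≡o⇒+m≡+o-+n x³+y³+b⁴≡a⁴
    y³+b⁴>0 : 0 ℕ.< y ℕ.^ 3 ℕ.+ b ℕ.^ 4
    y³+b⁴>0 = ℕ.<-≤-trans (ℕ.m^n>0 y 3) (ℕ.m≤m+n (y ℕ.^ 3) (b ℕ.^ 4))
    b⁴<a⁴ : b ℕ.^ 4 ℕ.< a ℕ.^ 4
    b⁴<a⁴ = subst (b ℕ.^ 4 ℕ.<_) x³+y³+b⁴≡a⁴
      (ℕ.m<n+m (b ℕ.^ 4) (ℕ.<-≤-trans (ℕ.m^n>0 x 3) (ℕ.m≤m+n (x ℕ.^ 3) (y ℕ.^ 3))))

  nontrivialSolution-minus : ∀ {x y a b}
    .{{_ : NonZero x}} .{{_ : NonZero y}} .{{_ : NonZero a}} .{{_ : NonZero b}} →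
    x ℕ.^ 3 ℕ.+ b ℕ.^ 4 ≡ a ℕ.^ 4 ℕ.+ y ℕ.^ 3 → y ℕ.^ 3 ℕ.< b ℕ.^ 4 → b ℕ.< a →
    (∀ {d} → d ∣ x → d ∣ y → d ∣ a → d ∣ b → d ∣ 1) →
    Positive (+ x , + y , + a , + b) × NontrivialSolution false (+ x , + y , + a , + b)
  nontrivialSolution-minus {x} {y} {a} {b} x³+b⁴≡a⁴+y³ y³<b⁴ b<a =
    nontrivialSolution false solution (-m+n≢0 (ℕ.<⇒≢ y³<b⁴)) (ℕ.>⇒≢ (ℕ.^-monoˡ-< 4 b<a))
    where
    solution : + (x ℕ.^ 3) - + (y ℕ.^ 3) ≡ + (a ℕ.^ 4) - + (b ℕ.^ 4)
    solution = m+n≡o+p⇒+m-+p≡+o-+n {x ℕ.^ 3} {b ℕ.^ 4} {a ℕ.^ 4} {y ℕ.^ 3} x³+b⁴≡a⁴+y³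

open import Data.Integer using (+_; ∣_∣)
open import Data.List using (map)
open import Data.List.Membership.Propositional using (_∈_)
open import Data.List.Membership.Propositional.Properties using (∈-map⁺)
open import Data.List.Extrema.Nat using (max; xs≤max)
import Data.List.Relation.Unary.All as All
open import Data.Nat using (suc; _+_; _*_; _^_; _<_; >-nonZero⁻¹; z<s; s<s)
open import Data.Nat.Properties
  using (<⇒≱; m<m+n; m≤m*n; m≤n*m; n<1+n; *-mono-<; *-monoˡ-<; module ≤-Reasoning)
open import Data.Nat.Divisibility using (∣m+n∣m⇒∣n; ∣m⇒∣m*n; ∣n⇒∣m*n)
open import Data.Nat.Solver using (module +-*-Solver)
open import Relation.Nullary using (¬_)

infinitelyMany-unbounded : {P : Quad → Set} (size : Quad → ℕ) (f : ℕ → Quad) →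
  (∀ n → P (f n)) → (∀ n → n < size (f n)) → InfinitelyMany P
infinitelyMany-unbounded size f P[f] n<size L = f N , P[f] N , f[N]∉L
  where
  N : ℕ
  N = max 0 (map size L)
  f[N]∉L : ¬ (f N ∈ L)
  f[N]∉L f[N]∈L = <⇒≱ (n<size N) (All.lookup (xs≤max 0 (map size L)) (∈-map⁺ size f[N]∈L))

∣m*n+1∣m⇒∣1 : ∀ {d m} n → d ∣ m * n + 1 → d ∣ m → d ∣ 1
∣m*n+1∣m⇒∣1 n d∣m*n+1 d∣m = ∣m+n∣m⇒∣n d∣m*n+1 (∣m⇒∣m*n n d∣m)

∣y∣ : Quad → ℕ
∣y∣ (_ , y , _ , _) = ∣ y ∣

module _ where
  open +-*-Solver

  [2m]³≡8m³ : ∀ m → (2 * m) ^ 3 ≡ 8 * m ^ 3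
  [2m]³≡8m³ = solve 1 (λ m → (con 2 :* m) :^ 3 := con 8 :* m :^ 3) refl

  plusIdentity : ∀ b → (2 * (b + 1)) ^ 3 + 8 * (b + 1) + b ^ 4 ≡ (b + 2) ^ 4
  plusIdentity = solve 1 (λ b →
    (con 2 :* (b :+ con 1)) :^ 3 :+ con 8 :* (b :+ con 1) :+ b :^ 4 := (b :+ con 2) :^ 4) refl

  [st]³≡s³t³ : ∀ s t → (s * t) ^ 3 ≡ s ^ 3 * t ^ 3
  [st]³≡s³t³ = solve 2 (λ s t → (s :* t) :^ 3 := s :^ 3 :* t :^ 3) refl

  minusIdentity : ∀ u →
    (1 + 22 * u) * (1 + 10 * u) ^ 3 + (1 + 9 * u) ^ 4 ≡ (1 + 13 * u) ^ 4 + (1 + 12 * u) ^ 3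
  minusIdentity = solve 1 (λ u →
    (con 1 :+ con 22 :* u) :* (con 1 :+ con 10 :* u) :^ 3 :+ (con 1 :+ con 9 :* u) :^ 4
      := (con 1 :+ con 13 :* u) :^ 4 :+ (con 1 :+ con 12 :* u) :^ 3) refl

  minusGap : ∀ u → (1 + 9 * u) ^ 4 ≡ (1 + 12 * u) ^ 3 + u * u * (54 + 1188 * u + 6561 * (u * u))
  minusGap = solve 1 (λ u → (con 1 :+ con 9 :* u) :^ 4
    := (con 1 :+ con 12 :* u) :^ 3 :+ u :* u :* (con 54 :+ con 1188 :* u :+ con 6561 :* (u :* u))) refl

  13b≡9a+4 : ∀ u → 13 * (1 + 9 * u) ≡ 9 * (1 + 13 * u) + 4
  13b≡9a+4 = solve 1 (λ u →
    con 13 :* (con 1 :+ con 9 :* u) := con 9 :* (con 1 :+ con 13 :* u) :+ con 4) refl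

  1+12u≡4[3u]+1 : ∀ u → 1 + 12 * u ≡ 4 * (3 * u) + 1
  1+12u≡4[3u]+1 = solve 1 (λ u → con 1 :+ con 12 :* u := con 4 :* (con 3 :* u) :+ con 1) refl

plusSolution : ∀ m b → m ^ 3 ≡ b + 1 → (2 * (b + 1)) ^ 3 + (2 * m) ^ 3 + b ^ 4 ≡ (b + 2) ^ 4
plusSolution m b m³≡b+1 = begin
  (2 * (b + 1)) ^ 3 + (2 * m) ^ 3 + b ^ 4   ≡⟨ cong (λ k → (2 * (b + 1)) ^ 3 + k + b ^ 4) [2m]³≡8[b+1] ⟩
  (2 * (b + 1)) ^ 3 + 8 * (b + 1) + b ^ 4   ≡⟨ plusIdentity b ⟩
  (b + 2) ^ 4                               ∎
  where
  open ≡-Reasoning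
  [2m]³≡8[b+1] : (2 * m) ^ 3 ≡ 8 * (b + 1)
  [2m]³≡8[b+1] = trans ([2m]³≡8m³ m) (cong (8 *_) m³≡b+1)

minusSolution : ∀ s u → s ^ 3 ≡ 1 + 22 * u →
  (s * (1 + 10 * u)) ^ 3 + (1 + 9 * u) ^ 4 ≡ (1 + 13 * u) ^ 4 + (1 + 12 * u) ^ 3
minusSolution s u s³≡1+22u = begin
  (s * (1 + 10 * u)) ^ 3 + (1 + 9 * u) ^ 4            ≡⟨ cong (_+ (1 + 9 * u) ^ 4) [st]³≡[1+22u]t³ ⟩
  (1 + 22 * u) * (1 + 10 * u) ^ 3 + (1 + 9 * u) ^ 4   ≡⟨ minusIdentity u ⟩
  (1 + 13 * u) ^ 4 + (1 + 12 * u) ^ 3                 ∎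
  where
  open ≡-Reasoning
  [st]³≡[1+22u]t³ : (s * (1 + 10 * u)) ^ 3 ≡ (1 + 22 * u) * (1 + 10 * u) ^ 3
  [st]³≡[1+22u]t³ = trans ([st]³≡s³t³ s (1 + 10 * u)) (cong (_* (1 + 10 * u) ^ 3) s³≡1+22u)

[1+12u]³<[1+9u]⁴ : ∀ u .{{_ : NonZero u}} → (1 + 12 * u) ^ 3 < (1 + 9 * u) ^ 4
[1+12u]³<[1+9u]⁴ u =
  subst ((1 + 12 * u) ^ 3 <_) (sym (minusGap u)) (m<m+n _ (*-mono-< (*-mono-< u>0 u>0) z<s))
  where
  u>0 : 0 < u
  u>0 = >-nonZero⁻¹ u

minusCoprime : ∀ u {d} → d ∣ 1 + 12 * u → d ∣ 1 + 13 * u → d ∣ 1 + 9 * u → d ∣ 1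
minusCoprime u {d} d∣y d∣a d∣b = ∣m*n+1∣m⇒∣1 (3 * u) (subst (d ∣_) (1+12u≡4[3u]+1 u) d∣y) d∣4
  where
  d∣4 : d ∣ 4
  d∣4 = ∣m+n∣m⇒∣n (subst (d ∣_) (13b≡9a+4 u) (∣n⇒∣m*n 13 d∣b)) (∣n⇒∣m*n 9 d∣a)

module PlusFamily (n : ℕ) where
  open +-*-Solver

  m q b : ℕ
  m = 2 * suc n
  -- q = 4(n + 1)³ − 1, so that b = 2q + 1 = m³ − 1 with no truncated subtraction.
  q = 3 + 4 * (n * (3 + 3 * n + n * n))
  b = 2 * q + 1

  quadruple : Quad
  quadruple = + (2 * (b + 1)) , + (2 * m) , + (b + 2) , + b

  m³≡b+1 : m ^ 3 ≡ b + 1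
  m³≡b+1 = solve 1 (λ n → (con 2 :* (con 1 :+ n)) :^ 3
    := con 2 :* (con 3 :+ con 4 :* (n :* (con 3 :+ con 3 :* n :+ n :* n))) :+ con 1 :+ con 1) refl n

  nontrivial : Positive quadruple × NontrivialSolution true quadruple
  nontrivial = nontrivialSolution-plus (plusSolution m b m³≡b+1)
    (λ _ _ d∣b+2 d∣b → ∣m*n+1∣m⇒∣1 q d∣b (∣m+n∣m⇒∣n d∣b+2 d∣b))

  unbounded : n < ∣y∣ quadruple
  unbounded = begin-strict
    n       <⟨ n<1+n n ⟩
    suc n   ≤⟨ m≤n*m (suc n) 2 ⟩
    m       ≤⟨ m≤n*m m 2 ⟩
    2 * m   ∎
    where open ≤-Reasoning

module MinusFamily (n : ℕ) where
  open +-*-Solver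

  s u : ℕ
  s = 1 + 22 * suc n
  u = suc n * (3 + 66 * suc n + 484 * (suc n * suc n))

  quadruple : Quad
  quadruple = + (s * (1 + 10 * u)) , + (1 + 12 * u) , + (1 + 13 * u) , + (1 + 9 * u)

  s³≡1+22u : s ^ 3 ≡ 1 + 22 * u
  s³≡1+22u = solve 1 (λ n → (con 1 :+ con 22 :* (con 1 :+ n)) :^ 3
    := con 1 :+ con 22 :* ((con 1 :+ n)
         :* (con 3 :+ con 66 :* (con 1 :+ n) :+ con 484 :* ((con 1 :+ n) :* (con 1 :+ n))))) refl n

  nontrivial : Positive quadruple × NontrivialSolution false quadruple
  nontrivial = nontrivialSolution-minus (minusSolution s u s³≡1+22u) ([1+12u]³<[1+9u]⁴ u)
    (s<s (*-monoˡ-< u {9} {13} (m<m+n 9 z<s))) (λ _ → minusCoprime u)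

  unbounded : n < ∣y∣ quadruple
  unbounded = begin-strict
    n          <⟨ n<1+n n ⟩
    suc n      ≤⟨ m≤m*n (suc n) (3 + 66 * suc n + 484 * (suc n * suc n)) ⟩
    u          ≤⟨ m≤n*m u 12 ⟩
    12 * u     <⟨ n<1+n (12 * u) ⟩
    1 + 12 * u ∎
    where open ≤-Reasoning

mainTheorem1 : (s : Bool) →
    InfinitelyMany (λ q → Positive q × NontrivialSolution s q)
mainTheorem1 true  =
  infinitelyMany-unbounded ∣y∣ PlusFamily.quadruple PlusFamily.nontrivial PlusFamily.unbounded
mainTheorem1 false =
  infinitelyMany-unbounded ∣y∣ MinusFamily.quadruple MinusFamily.nontrivial MinusFamily.unbounded
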